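{- Let $n,k,r$ be integers with $n\geq 2k^2$ and $r\geq 2$. Let $H$ be an $n$-vertex $k$-graph with an edge-coloring $c:E(H)\to\{C_1,\dots,C_r\}$, assume $H$ contains no good gadget of the first, second or third kind, and $\delta(H)>\frac12\binom{n-1}{k-1}+\frac{k^2+1}{2}\binom{n-2}{k-2}$. Then: (A) every ordered pair $(u,v)$ of distinct vertices of $H$ has a unique type, which is either type $\mathbf S$ or type $\mathbf{C_iC_j}$ for some $1\leq i\neq j\leq r$; (B) if $c$ is not monochromatic, then there exist distinct vertices $u,v$ such that $(u,v)$ is not type $\mathbf S$.
   Context: A $k$-graph is a hypergraph whose edges are $k$-element vertex sets; $\delta(H)$ is its minimum vertex degree. For a vertex $x$, $N_H(x)$ is the family of $(k-1)$-sets $S\subseteq V(H)\setminus\{x\}$ with $S\cup\{x\}\in E(H)$; $uT$ denotes $T\cup\{u\}$. For distinct $u,v$ and $T\in N_H(u)\cap N_H(v)$: $uTv$ is $\mathbf S$ if $c(uT)=c(vT)$, and $uTv$ is $\mathbf{C_iC_j}$ ($i\neq j$) if $c(uT)=C_i$, $c(vT)=C_j$. An ordered pair $(u,v)$ of distinct vertices is of type $\mathbf S$ (resp. type $\mathbf{C_iC_j}$) if there are at least $k^2\binom{n-2}{k-2}$ sets $T\in N_H(u)\cap N_H(v)$ with $uTv$ being $\mathbf S$ (resp. $\mathbf{C_iC_j}$). The color profile of a set of edges is the vector whose $i$-th entry is the number of its edges colored $C_i$. Good gadgets (w.r.t. $c$): First kind: distinct vertices $u,v$ and disjoint $T_1,T_2\in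 N_H(u)\cap N_H(v)$ such that $\{T_1u,T_2v\}$ and $\{T_1v,T_2u\}$ have different color profiles. Second kind: distinct vertices $u_1,u_2,u_3$ and pairwise disjoint $T_1\in N_H(u_2)\cap N_H(u_3)$, $T_2\in N_H(u_1)\cap N_H(u_3)$, $T_3\in N_H(u_1)\cap N_H(u_2)$ such that $\{T_1u_2,T_2u_3,T_3u_1\}$ and $\{T_1u_3,T_2u_1,T_3u_2\}$ have different color profiles. Third kind: edges $e,f$ with $V(e)\setminus V(f)=\{u_1,\dots,u_\ell\}$, $V(f)\setminus V(e)=\{v_1,\dots,v_\ell\}$ for some $1\leq\ell\leq k$, and pairwise disjoint $T_i\in N_H(u_i)\cap N_H(v_i)$, disjoint from $V(e)\cup V(f)$, such that $\{u_1T_1,\dots,u_\ell T_\ell,f\}$ and $\{v_1T_1,\dots,v_\ell T_\ell,e\}$ have different color profiles. -}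

module Defs where

open import Data.Nat using (ℕ; zero; suc; _+_; _*_; _∸_; _≤_; _<_)
open import Data.Nat.Combinatorics using (_C_)
open import Data.Bool using (Bool; true; false; _∧_; not; if_then_else_)
open import Data.Fin using (Fin)
open import Data.Fin.Subset using (Subset; _∈_; _∉_; _∪_; ⁅_⁆; ∣_∣; Empty; _∩_)
open import Data.Fin.Subset.Properties using (_∈?_)
open import Data.Vec using ([]; _∷_)
open import Data.List using (List; []; _∷_; map; _++_; allFin)
open import Data.Product using (Σ; _×_; ∃; ∃-syntax; _,_)
open import Relation.Nullary using (¬_; does)
open import Relation.Binary.PropositionalEquality using (_≡_; _≢_)
import Data.Fin as F
import Data.Nat as N

allSubsets : (n : ℕ) → List (Subset n)
allSubsets zero    = [] ∷ []
allSubsets (suc n) = map (true ∷_) (allSubsets n) ++ map (false ∷_) (allSubsets n)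

count : {A : Set} → (A → Bool) → List A → ℕ
count p []       = 0
count p (x ∷ xs) = if p x then suc (count p xs) else count p xs

_∈ᵇ_ : {n : ℕ} → Fin n → Subset n → Bool
x ∈ᵇ S = does (x ∈? S)

_=ᶠ_ : {n : ℕ} → Fin n → Fin n → Bool
i =ᶠ j = does (i F.≟ j)

_=ᴺ_ : ℕ → ℕ → Bool
a =ᴺ b = does (a N.≟ b)

record KGraph (n k : ℕ) : Set where
  field
    E       : Subset n → Bool
    uniform : ∀ (e : Subset n) → E e ≡ true → ∣ e ∣ ≡ k
open KGraph public

module _ {n k : ℕ} (H : KGraph n k) where

  IsEdge : Subset n → Set
  IsEdge e = E H e ≡ true

  deg : Fin n → ℕ
  deg x = count (λ e → E H e ∧ (x ∈ᵇ e)) (allSubsets n)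

  _·_ : Fin n → Subset n → Subset n
  u · T = T ∪ ⁅ u ⁆

  inNᵇ : Fin n → Subset n → Bool
  inNᵇ u T = not (u ∈ᵇ T) ∧ (∣ T ∣ =ᴺ (k ∸ 1)) ∧ E H (u · T)

  InN : Fin n → Subset n → Set
  InN u T = u ∉ T × ∣ T ∣ ≡ k ∸ 1 × IsEdge (u · T)

  Disjoint : Subset n → Subset n → Set
  Disjoint A B = Empty (A ∩ B)

  module _ {r : ℕ} (c : Subset n → Fin r) where

    thr : ℕ
    thr = k * k * ((n ∸ 2) C (k ∸ 2))

    countS : Fin n → Fin n → ℕ
    countS u v = count (λ T → inNᵇ u T ∧ inNᵇ v T ∧ (c (u · T) =ᶠ c (v · T)))
                       (allSubsets n)

    countCC : Fin r → Fin r → Fin n → Fin n → ℕ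
    countCC i j u v = count (λ T → inNᵇ u T ∧ inNᵇ v T ∧ (c (u · T) =ᶠ i)
                                   ∧ (c (v · T) =ᶠ j))
                            (allSubsets n)

    TypeS : Fin n → Fin n → Set
    TypeS u v = thr ≤ countS u v

    -- (for i ≢ j)
    TypeCC : Fin r → Fin r → Fin n → Fin n → Set
    TypeCC i j u v = thr ≤ countCC i j u v

    profile : List (Subset n) → Fin r → ℕ
    profile L i = count (λ e → c e =ᶠ i) L

    DiffProfile : List (Subset n) → List (Subset n) → Set
    DiffProfile L M = ∃[ i ] profile L i ≢ profile M i

    GoodGadget1 : Set
    GoodGadget1 =
      Σ (Fin n) λ u → Σ (Fin n) λ v → Σ (Subset n) λ T₁ → Σ (Subset n) λ T₂ →
        u ≢ v × Disjoint T₁ T₂ ×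
        InN u T₁ × InN v T₁ × InN u T₂ × InN v T₂ ×
        DiffProfile ((u · T₁) ∷ (v · T₂) ∷ []) ((v · T₁) ∷ (u · T₂) ∷ [])

    GoodGadget2 : Set
    GoodGadget2 =
      Σ (Fin n) λ u₁ → Σ (Fin n) λ u₂ → Σ (Fin n) λ u₃ →
      Σ (Subset n) λ T₁ → Σ (Subset n) λ T₂ → Σ (Subset n) λ T₃ →
        u₁ ≢ u₂ × u₁ ≢ u₃ × u₂ ≢ u₃ ×
        Disjoint T₁ T₂ × Disjoint T₁ T₃ × Disjoint T₂ T₃ ×
        InN u₂ T₁ × InN u₃ T₁ × InN u₁ T₂ × InN u₃ T₂ × InN u₁ T₃ × InN u₂ T₃ ×
        DiffProfile ((u₂ · T₁) ∷ (u₃ · T₂) ∷ (u₁ · T₃) ∷ [])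
                    ((u₃ · T₁) ∷ (u₁ · T₂) ∷ (u₂ · T₃) ∷ [])

    GoodGadget3 : Set
    GoodGadget3 =
      Σ (Subset n) λ e → Σ (Subset n) λ f → Σ ℕ λ ℓ →
      Σ (Fin ℓ → Fin n) λ us → Σ (Fin ℓ → Fin n) λ vs →
      Σ (Fin ℓ → Subset n) λ T →
        IsEdge e × IsEdge f × 1 ≤ ℓ × ℓ ≤ k ×
        (∀ i j → us i ≡ us j → i ≡ j) ×
        (∀ x → (x ∈ e × x ∉ f) → ∃[ i ] us i ≡ x) ×
        (∀ i → us i ∈ e × us i ∉ f) ×
        (∀ i j → vs i ≡ vs j → i ≡ j) ×
        (∀ x → (x ∈ f × x ∉ e) → ∃[ i ] vs i ≡ x) ×
        (∀ i → vs i ∈ f × vs i ∉ e) ×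
        (∀ i j → i ≢ j → Disjoint (T i) (T j)) ×
        (∀ i → InN (us i) (T i) × InN (vs i) (T i)) ×
        (∀ i → Disjoint (T i) (e ∪ f)) ×
        DiffProfile (map (λ i → us i · T i) (allFin ℓ) ++ (f ∷ []))
                    (map (λ i → vs i · T i) (allFin ℓ) ++ (e ∷ []))

-- Two vertices u ≠ v of H have more than k²·C(n-2,k-2) common link sets T ∈ N(u) ∩ N(v): the degree
-- condition bounds |N(u)| + |N(v)| from below, while |N(u) ∪ N(v)| ≤ C(n-1,k-1) + C(n-2,k-2). A vertex
-- w ∉ {u, v} lies in at most C(n-2,k-2) of them, so for every set W of at most k² vertices besides u
-- and v, some common link set of u and v avoids W.
--
-- (A) Without good gadgets of the first kind, if uT₁v is not S and T₂ is a common link set disjoint from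
-- T₁, then uT₂ and vT₂ have the colours of uT₁ and vT₁. Comparing any two common link sets with a third
-- one disjoint from both, either every uTv is S or all of them are C_iC_j for one pair (i, j), and this
-- pattern is the unique type of (u, v).
--
-- (B) If every pair were of type S, then every uTv would be S. Take edges e, f of different colours, pair
-- the vertices u₁, …, u_ℓ of e ∖ f with the vertices v₁, …, v_ℓ of f ∖ e, and choose greedily pairwise
-- disjoint common link sets Tᵢ of uᵢ and vᵢ avoiding e ∪ f (each choice forbids k - 1 more vertices, and
-- at most (ℓ + 1)(k - 1) < k² are ever forbidden). The families {uᵢTᵢ} ∪ {f} and {vᵢTᵢ} ∪ {e} then differ
-- exactly by one edge of colour c(f) against one of colour c(e): a good gadget of the third kind.

module Submission where

open import Defs
open import Data.Bool using (Bool; true; false; T; _∧_; _∨_; not)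
open import Data.Bool.Properties using (T-∧; T-≡; ∧-zeroʳ; ∧-identityʳ; ∨-identityʳ)
open import Data.Fin using (Fin; zero; suc; punchIn; punchOut; cast; _≟_)
open import Data.Fin.Properties using (punchIn-punchOut; cast-involutive; any?) renaming (suc-injective to fsuc-injective)
open import Data.Fin.Subset using (Subset; inside; outside; _∈_; _∉_; _∪_; _∩_; _─_; ⁅_⁆; ∣_∣; Empty)
open import Data.Fin.Subset.Properties using (_∈?_; ∪-identityʳ; ∩-comm; x∈p∩q⁻; x∈p∪q⁻; x∈p∧x∉q⇒x∈p─q; p─q⊆p; ∣p─q∣≤∣p∣)
open import Data.Empty using (⊥-elim)
open import Data.List using (List; []; _∷_; _++_; map; length; tabulate; allFin)
open import Data.Bool.ListAction using (all)
open import Data.List.Properties using (length-tabulate; length-++)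
open import Data.List.Membership.Propositional.Properties using (∈-tabulate⁺; ∈-++⁺ˡ; ∈-++⁺ʳ)
import Data.List.Relation.Unary.All as All
open import Data.List.Relation.Unary.All.Properties using (all⁺; all-anti-mono)
open import Data.List.Membership.Propositional using () renaming (_∈_ to _∈ₗ_)
open import Data.List.Relation.Unary.Any using (here; there)
open import Data.Nat using (ℕ; zero; suc; pred; _+_; _*_; _∸_; _≤_; _<_; z≤n; s≤s)
import Data.Nat as ℕ
open import Data.Nat.Combinatorics using (_C_; nCk+nC[k+1]≡[n+1]C[k+1])
open import Data.Nat.Properties hiding (_≟_)
open import Data.Nat.Tactic.RingSolver using (solve-∀)
open import Algebra.Properties.CommutativeSemigroup +-commutativeSemigroup using (interchange)
open import Data.Vec using ([]; _∷_; lookup; insertAt; here; there)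
open import Data.Vec.Properties using (insertAt-lookup; insertAt-punchIn)
open import Data.Product using (Σ; _×_; ∃; _,_; proj₁; proj₂)
open import Data.Sum using (_⊎_; inj₁; inj₂)
open import Function using (_∘_; Equivalence)
open import Relation.Nullary using (¬_; Dec; yes; no; does; ¬?; _×-dec_)
open import Relation.Nullary.Decidable using (decidable-stable)
open import Relation.Binary.PropositionalEquality

-- Boolean tests and counting along lists

T-∧⁻ : ∀ {x y} → T (x ∧ y) → T x × T y
T-∧⁻ = Equivalence.to T-∧

T-∧⁺ : ∀ {x y} → T x → T y → T (x ∧ y)
T-∧⁺ a b = Equivalence.from T-∧ (a , b)

does⇒ : ∀ {P : Set} (P? : Dec P) → T (does P?) → P
does⇒ (yes p) _ = p

⇒does : ∀ {P : Set} (P? : Dec P) → P → T (does P?)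
⇒does (yes _) _ = _
⇒does (no ¬p) p = ¬p p

not-does⇒ : ∀ {P : Set} (P? : Dec P) → T (not (does P?)) → ¬ P
not-does⇒ (no ¬p) _ = ¬p

⇒not-does : ∀ {P : Set} (P? : Dec P) → ¬ P → T (not (does P?))
⇒not-does (yes p) ¬p = ¬p p
⇒not-does (no _) _ = _

module _ {A : Set} where

  count-∷-true : ∀ {p : A → Bool} {x} xs → T (p x) → count p (x ∷ xs) ≡ suc (count p xs)
  count-∷-true {p} {x} xs px with p x
  ... | true = refl

  count-∷-false : ∀ {p : A → Bool} {x} xs → ¬ T (p x) → count p (x ∷ xs) ≡ count p xs
  count-∷-false {p} {x} xs ¬px with p x
  ... | true = ⊥-elim (¬px _)
  ... | false = refl

  count-∷∷-≢ : ∀ (p : A → Bool) {x y x′ y′} →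
    T (p x) → ¬ T (p x′) → ¬ T (p y′) → count p (x ∷ y ∷ []) ≢ count p (x′ ∷ y′ ∷ [])
  count-∷∷-≢ p {x} {y} {x′} {y′} px ¬px′ ¬py′ eq = 0≢1+n (begin
    0                          ≡⟨ count-∷-false {p = p} [] ¬py′ ⟨
    count p (y′ ∷ [])          ≡⟨ count-∷-false {p = p} (y′ ∷ []) ¬px′ ⟨
    count p (x′ ∷ y′ ∷ [])     ≡⟨ eq ⟨
    count p (x ∷ y ∷ [])       ≡⟨ count-∷-true {p = p} (y ∷ []) px ⟩
    suc (count p (y ∷ []))     ∎)
    where open ≡-Reasoning

  count-++ : ∀ (p : A → Bool) xs ys → count p (xs ++ ys) ≡ count p xs + count p ys
  count-++ p [] ys = refl
  count-++ p (x ∷ xs) ys with p x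
  ... | true = cong suc (count-++ p xs ys)
  ... | false = count-++ p xs ys

  count-map : ∀ {B : Set} (p : A → Bool) (g : B → A) xs → count p (map g xs) ≡ count (p ∘ g) xs
  count-map p g [] = refl
  count-map p g (x ∷ xs) with p (g x)
  ... | true = cong suc (count-map p g xs)
  ... | false = count-map p g xs

  count-mono : ∀ {p q : A → Bool} → (∀ x → T (p x) → T (q x)) → ∀ xs → count p xs ≤ count q xs
  count-mono p⇒q [] = z≤n
  count-mono {p} {q} p⇒q (x ∷ xs) with p x | q x | p⇒q x
  ... | true  | true  | _ = s≤s (count-mono p⇒q xs)
  ... | true  | false | h = ⊥-elim (h _)
  ... | false | true  | _ = m≤n⇒m≤1+n (count-mono p⇒q xs)
  ... | false | false | _ = count-mono p⇒q xs

  count-cong : ∀ {p q : A → Bool} → (∀ x → p x ≡ q x) → ∀ xs → count p xs ≡ count q xs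
  count-cong p≗q xs = ≤-antisym (count-mono (λ x → subst T (p≗q x)) xs)
                                (count-mono (λ x → subst T (sym (p≗q x))) xs)

  count-none : ∀ {p : A → Bool} → (∀ x → ¬ T (p x)) → ∀ xs → count p xs ≡ 0
  count-none ¬p [] = refl
  count-none {p} ¬p (x ∷ xs) = trans (count-∷-false xs (¬p x)) (count-none ¬p xs)

  count-witness : ∀ (p : A → Bool) xs → 0 < count p xs → ∃ λ x → T (p x)
  count-witness p (x ∷ xs) pos with p x in px
  ... | true = x , subst T (sym px) _
  ... | false = count-witness p xs pos

  count≤length : ∀ (p : A → Bool) xs → count p xs ≤ length xs
  count≤length p [] = z≤n
  count≤length p (x ∷ xs) with p x
  ... | true = s≤s (count≤length p xs)
  ... | false = m≤n⇒m≤1+n (count≤length p xs)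

  count<length : ∀ (p : A → Bool) {x} xs → x ∈ₗ xs → ¬ T (p x) → count p xs < length xs
  count<length p (x ∷ xs) (here refl) ¬px =
    subst (_< suc (length xs)) (sym (count-∷-false xs ¬px)) (s≤s (count≤length p xs))
  count<length p (y ∷ xs) (there x∈xs) ¬px with p y
  ... | true = s≤s (count<length p xs x∈xs ¬px)
  ... | false = m≤n⇒m≤1+n (count<length p xs x∈xs ¬px)

  count-split : ∀ (q p : A → Bool) xs →
    count p xs ≡ count (λ x → q x ∧ p x) xs + count (λ x → not (q x) ∧ p x) xs
  count-split q p [] = refl
  count-split q p (x ∷ xs) with q x | p x
  ... | true  | true  = cong suc (count-split q p xs)
  ... | false | true  = trans (cong suc (count-split q p xs)) (sym (+-suc _ _))
  ... | true  | false = count-split q p xs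
  ... | false | false = count-split q p xs

  count-∧+count-∨ : ∀ (p q : A → Bool) xs →
    count p xs + count q xs ≡ count (λ x → p x ∧ q x) xs + count (λ x → p x ∨ q x) xs
  count-∧+count-∨ p q [] = refl
  count-∧+count-∨ p q (x ∷ xs) with p x | q x
  ... | true  | true  =
    cong suc (trans (+-suc _ _) (trans (cong suc (count-∧+count-∨ p q xs)) (sym (+-suc _ _))))
  ... | true  | false = trans (cong suc (count-∧+count-∨ p q xs)) (sym (+-suc _ _))
  ... | false | true  = trans (+-suc _ _) (trans (cong suc (count-∧+count-∨ p q xs)) (sym (+-suc _ _)))
  ... | false | false = count-∧+count-∨ p q xs

count-map-cong : ∀ {A B : Set} (p : A → Bool) {g h : B → A} → (∀ x → p (g x) ≡ p (h x)) →
  ∀ xs → count p (map g xs) ≡ count p (map h xs)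
count-map-cong p {g} {h} p∘g≗p∘h xs =
  trans (count-map p g xs) (trans (count-cong p∘g≗p∘h xs) (sym (count-map p h xs)))

-- Counting subsets of a finite set

∈ᵇ≡lookup : ∀ {n} (x : Fin n) (p : Subset n) → x ∈ᵇ p ≡ lookup p x
∈ᵇ≡lookup zero    (inside  ∷ p) = refl
∈ᵇ≡lookup zero    (outside ∷ p) = refl
∈ᵇ≡lookup (suc x) (_       ∷ p) = ∈ᵇ≡lookup x p

module _ {n : ℕ} (p : Subset n) (x : Fin (suc n)) where

  ∈ᵇ-insertAt : ∀ b → x ∈ᵇ insertAt p x b ≡ b
  ∈ᵇ-insertAt b = trans (∈ᵇ≡lookup x _) (insertAt-lookup p x b)

  punchIn-∈ᵇ-insertAt : ∀ b y → punchIn x y ∈ᵇ insertAt p x b ≡ y ∈ᵇ p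
  punchIn-∈ᵇ-insertAt b y =
    trans (∈ᵇ≡lookup (punchIn x y) _) (trans (insertAt-punchIn p x b y) (sym (∈ᵇ≡lookup y p)))

∣insertAt-inside∣ : ∀ {n} (p : Subset n) x → ∣ insertAt p x inside ∣ ≡ suc ∣ p ∣
∣insertAt-inside∣ p             zero    = refl
∣insertAt-inside∣ (inside  ∷ p) (suc x) = cong suc (∣insertAt-inside∣ p x)
∣insertAt-inside∣ (outside ∷ p) (suc x) = ∣insertAt-inside∣ p x

∣insertAt-outside∣ : ∀ {n} (p : Subset n) x → ∣ insertAt p x outside ∣ ≡ ∣ p ∣
∣insertAt-outside∣ p             zero    = refl
∣insertAt-outside∣ (inside  ∷ p) (suc x) = cong suc (∣insertAt-outside∣ p x)
∣insertAt-outside∣ (outside ∷ p) (suc x) = ∣insertAt-outside∣ p x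

insertAt-outside∪⁅x⁆ : ∀ {n} (p : Subset n) x → insertAt p x outside ∪ ⁅ x ⁆ ≡ insertAt p x inside
insertAt-outside∪⁅x⁆ p       zero    = cong (inside ∷_) (∪-identityʳ p)
insertAt-outside∪⁅x⁆ (b ∷ p) (suc x) = cong₂ _∷_ (∨-identityʳ b) (insertAt-outside∪⁅x⁆ p x)

count-allSubsets-suc : ∀ {n} (P : Subset (suc n) → Bool) →
  count P (allSubsets (suc n)) ≡
  count (P ∘ (inside ∷_)) (allSubsets n) + count (P ∘ (outside ∷_)) (allSubsets n)
count-allSubsets-suc {n} P =
  trans (count-++ P (map (inside ∷_) (allSubsets n)) _)
        (cong₂ _+_ (count-map P _ (allSubsets n)) (count-map P _ (allSubsets n)))

count-allSubsets-insertAt : ∀ {n} (x : Fin (suc n)) (P : Subset (suc n) → Bool) →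
  count P (allSubsets (suc n)) ≡
  count (λ S → P (insertAt S x inside)) (allSubsets n) + count (λ S → P (insertAt S x outside)) (allSubsets n)
count-allSubsets-insertAt zero P = count-allSubsets-suc P
count-allSubsets-insertAt {suc n} (suc x) P = begin
  count P (allSubsets (2 + n))
    ≡⟨ count-allSubsets-suc P ⟩
  count (P ∘ (inside ∷_)) (allSubsets (suc n)) + count (P ∘ (outside ∷_)) (allSubsets (suc n))
    ≡⟨ cong₂ _+_ (count-allSubsets-insertAt x (P ∘ (inside ∷_))) (count-allSubsets-insertAt x (P ∘ (outside ∷_))) ⟩
  (#[ inside , inside ] + #[ inside , outside ]) + (#[ outside , inside ] + #[ outside , outside ])
    ≡⟨ interchange #[ inside , inside ] _ _ _ ⟩
  (#[ inside , inside ] + #[ outside , inside ]) + (#[ inside , outside ] + #[ outside , outside ])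
    ≡⟨ sym (cong₂ _+_ (count-allSubsets-suc (λ S → P (insertAt S (suc x) inside)))
                       (count-allSubsets-suc (λ S → P (insertAt S (suc x) outside)))) ⟩
  count (λ S → P (insertAt S (suc x) inside)) (allSubsets (suc n))
    + count (λ S → P (insertAt S (suc x) outside)) (allSubsets (suc n)) ∎
  where
  open ≡-Reasoning
  #[_,_] : Bool → Bool → ℕ
  #[ b , b′ ] = count (λ S → P (b ∷ insertAt S x b′)) (allSubsets n)

count-size≡C : ∀ n m → count (λ S → ∣ S ∣ =ᴺ m) (allSubsets n) ≡ n C m
count-size≡C zero    zero    = refl
count-size≡C zero    (suc m) = refl
count-size≡C (suc n) zero    =
  trans (count-allSubsets-suc {n} (λ S → ∣ S ∣ =ᴺ zero))
        (cong₂ _+_ (count-none (λ _ ()) (allSubsets n)) (count-size≡C n zero))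
count-size≡C (suc n) (suc m) =
  trans (count-allSubsets-suc {n} (λ S → ∣ S ∣ =ᴺ suc m))
        (trans (cong₂ _+_ (count-size≡C n m) (count-size≡C n (suc m))) (nCk+nC[k+1]≡[n+1]C[k+1] n m))

count-size∧∉≡C : ∀ {n} (u : Fin n) m →
  count (λ S → (∣ S ∣ =ᴺ m) ∧ not (u ∈ᵇ S)) (allSubsets n) ≡ (n ∸ 1) C m
count-size∧∉≡C {suc n} u m =
  trans (count-allSubsets-insertAt u _)
        (cong₂ _+_ (count-none u∈ (allSubsets n))
                   (trans (count-cong u∉ (allSubsets n)) (count-size≡C n m)))
  where
  u∈ : ∀ S → ¬ T ((∣ insertAt S u inside ∣ =ᴺ m) ∧ not (u ∈ᵇ insertAt S u inside))
  u∈ S rewrite ∈ᵇ-insertAt S u inside = subst T (∧-zeroʳ _)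
  u∉ : ∀ S → (∣ insertAt S u outside ∣ =ᴺ m) ∧ not (u ∈ᵇ insertAt S u outside) ≡ (∣ S ∣ =ᴺ m)
  u∉ S rewrite ∈ᵇ-insertAt S u outside | ∣insertAt-outside∣ S u = ∧-identityʳ _

count-size∧∈≡C : ∀ {n} (w : Fin n) m →
  count (λ S → (∣ S ∣ =ᴺ suc m) ∧ (w ∈ᵇ S)) (allSubsets n) ≡ (n ∸ 1) C m
count-size∧∈≡C {suc n} w m =
  trans (count-allSubsets-insertAt w _)
        (trans (cong₂ _+_ (count-cong w∈ (allSubsets n)) (count-none w∉ (allSubsets n)))
               (trans (+-identityʳ _) (count-size≡C n m)))
  where
  w∈ : ∀ S → (∣ insertAt S w inside ∣ =ᴺ suc m) ∧ (w ∈ᵇ insertAt S w inside) ≡ (∣ S ∣ =ᴺ m)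
  w∈ S rewrite ∈ᵇ-insertAt S w inside | ∣insertAt-inside∣ S w = ∧-identityʳ _
  w∉ : ∀ S → ¬ T ((∣ insertAt S w outside ∣ =ᴺ suc m) ∧ (w ∈ᵇ insertAt S w outside))
  w∉ S rewrite ∈ᵇ-insertAt S w outside = subst T (∧-zeroʳ _)

count-size∧∉∧∈≡C : ∀ {n} {u w : Fin n} → u ≢ w → ∀ m →
  count (λ S → (∣ S ∣ =ᴺ suc m) ∧ not (u ∈ᵇ S) ∧ (w ∈ᵇ S)) (allSubsets n) ≡ (n ∸ 2) C m
count-size∧∉∧∈≡C {suc n} {u} {w} u≢w m =
  trans (count-allSubsets-insertAt u _)
        (cong₂ _+_ (count-none u∈ (allSubsets n))
                   (trans (count-cong u∉ (allSubsets n)) (count-size∧∈≡C (punchOut u≢w) m)))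
  where
  u∈ : ∀ S → ¬ T ((∣ insertAt S u inside ∣ =ᴺ suc m) ∧ not (u ∈ᵇ insertAt S u inside) ∧ (w ∈ᵇ insertAt S u inside))
  u∈ S rewrite ∈ᵇ-insertAt S u inside = subst T (∧-zeroʳ _)
  u∉ : ∀ S → (∣ insertAt S u outside ∣ =ᴺ suc m) ∧ not (u ∈ᵇ insertAt S u outside) ∧ (w ∈ᵇ insertAt S u outside)
           ≡ (∣ S ∣ =ᴺ suc m) ∧ (punchOut u≢w ∈ᵇ S)
  u∉ S rewrite ∈ᵇ-insertAt S u outside | ∣insertAt-outside∣ S u
             | sym (punchIn-∈ᵇ-insertAt S u outside (punchOut u≢w)) | punchIn-punchOut u≢w = refl

0<C : ∀ {n m} → m ≤ n → 0 < n C m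
0<C {n}     {zero}  _         = s≤s z≤n
0<C {suc n} {suc m} (s≤s m≤n) =
  subst (0 <_) (nCk+nC[k+1]≡[n+1]C[k+1] n m) (≤-trans (0<C m≤n) (m≤m+n _ _))

-- Differences and enumerations of subsets

x∈p─q⇒x∉q : ∀ {n} (p q : Subset n) {x} → x ∈ p ─ q → x ∉ q
x∈p─q⇒x∉q (inside ∷ p) (outside ∷ q) here ()
x∈p─q⇒x∉q (_      ∷ p) (inside  ∷ q) (there x∈p─q) (there x∈q) = x∈p─q⇒x∉q p q x∈p─q x∈q
x∈p─q⇒x∉q (_      ∷ p) (outside ∷ q) (there x∈p─q) (there x∈q) = x∈p─q⇒x∉q p q x∈p─q x∈q

∣p∩q∣+∣p─q∣≡∣p∣ : ∀ {n} (p q : Subset n) → ∣ p ∩ q ∣ + ∣ p ─ q ∣ ≡ ∣ p ∣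
∣p∩q∣+∣p─q∣≡∣p∣ []            []            = refl
∣p∩q∣+∣p─q∣≡∣p∣ (inside  ∷ p) (inside  ∷ q) = cong suc (∣p∩q∣+∣p─q∣≡∣p∣ p q)
∣p∩q∣+∣p─q∣≡∣p∣ (inside  ∷ p) (outside ∷ q) = trans (+-suc _ _) (cong suc (∣p∩q∣+∣p─q∣≡∣p∣ p q))
∣p∩q∣+∣p─q∣≡∣p∣ (outside ∷ p) (inside  ∷ q) = ∣p∩q∣+∣p─q∣≡∣p∣ p q
∣p∩q∣+∣p─q∣≡∣p∣ (outside ∷ p) (outside ∷ q) = ∣p∩q∣+∣p─q∣≡∣p∣ p q

∣p─q∣≡0⇒∣q─p∣≡0⇒p≡q : ∀ {n} (p q : Subset n) → ∣ p ─ q ∣ ≡ 0 → ∣ q ─ p ∣ ≡ 0 → p ≡ q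
∣p─q∣≡0⇒∣q─p∣≡0⇒p≡q []            []            _  _  = refl
∣p─q∣≡0⇒∣q─p∣≡0⇒p≡q (inside  ∷ p) (inside  ∷ q) h₁ h₂ = cong (inside ∷_) (∣p─q∣≡0⇒∣q─p∣≡0⇒p≡q p q h₁ h₂)
∣p─q∣≡0⇒∣q─p∣≡0⇒p≡q (outside ∷ p) (outside ∷ q) h₁ h₂ = cong (outside ∷_) (∣p─q∣≡0⇒∣q─p∣≡0⇒p≡q p q h₁ h₂)
∣p─q∣≡0⇒∣q─p∣≡0⇒p≡q (inside  ∷ p) (outside ∷ q) () _
∣p─q∣≡0⇒∣q─p∣≡0⇒p≡q (outside ∷ p) (inside  ∷ q) _ ()

enumerate : ∀ {n} (p : Subset n) → Fin ∣ p ∣ → Fin n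
enumerate (inside  ∷ p) zero    = zero
enumerate (inside  ∷ p) (suc i) = suc (enumerate p i)
enumerate (outside ∷ p) i       = suc (enumerate p i)

enumerate-∈ : ∀ {n} (p : Subset n) i → enumerate p i ∈ p
enumerate-∈ (inside  ∷ p) zero    = here
enumerate-∈ (inside  ∷ p) (suc i) = there (enumerate-∈ p i)
enumerate-∈ (outside ∷ p) i       = there (enumerate-∈ p i)

enumerate-injective : ∀ {n} (p : Subset n) {i j} → enumerate p i ≡ enumerate p j → i ≡ j
enumerate-injective (inside  ∷ p) {zero}  {zero}  _  = refl
enumerate-injective (inside  ∷ p) {suc i} {suc j} eq = cong suc (enumerate-injective p (fsuc-injective eq))
enumerate-injective (outside ∷ p) {i}     {j}     eq = enumerate-injective p (fsuc-injective eq)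

enumerate-surjective : ∀ {n} (p : Subset n) {x} → x ∈ p → ∃ λ i → enumerate p i ≡ x
enumerate-surjective (inside  ∷ p) here        = zero , refl
enumerate-surjective (inside  ∷ p) (there x∈p) with enumerate-surjective p x∈p
... | i , refl = suc i , refl
enumerate-surjective (outside ∷ p) (there x∈p) with enumerate-surjective p x∈p
... | i , refl = i , refl

members : ∀ {n} → Subset n → List (Fin n)
members p = tabulate (enumerate p)

∈-members : ∀ {n} {p : Subset n} {x} → x ∈ p → x ∈ₗ members p
∈-members {p = p} x∈p with enumerate-surjective p x∈p
... | i , refl = ∈-tabulate⁺ i

length-members : ∀ {n} (p : Subset n) → length (members p) ≡ ∣ p ∣
length-members p = length-tabulate (enumerate p)

module DifferencePairing {n} (p q : Subset n) (∣p∣≡∣q∣ : ∣ p ∣ ≡ ∣ q ∣) where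

  ℓ : ℕ
  ℓ = ∣ p ─ q ∣

  ℓ≡∣q─p∣ : ℓ ≡ ∣ q ─ p ∣
  ℓ≡∣q─p∣ = +-cancelˡ-≡ ∣ p ∩ q ∣ _ _ (begin
    ∣ p ∩ q ∣ + ∣ p ─ q ∣    ≡⟨ ∣p∩q∣+∣p─q∣≡∣p∣ p q ⟩
    ∣ p ∣                   ≡⟨ ∣p∣≡∣q∣ ⟩
    ∣ q ∣                   ≡⟨ ∣p∩q∣+∣p─q∣≡∣p∣ q p ⟨
    ∣ q ∩ p ∣ + ∣ q ─ p ∣    ≡⟨ cong (λ r → ∣ r ∣ + ∣ q ─ p ∣) (∩-comm q p) ⟩
    ∣ p ∩ q ∣ + ∣ q ─ p ∣    ∎)
    where open ≡-Reasoning

  -- The two differences have equal size only propositionally, hence the cast.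
  us vs : Fin ℓ → Fin n
  us = enumerate (p ─ q)
  vs = enumerate (q ─ p) ∘ cast ℓ≡∣q─p∣

  us-injective : ∀ i j → us i ≡ us j → i ≡ j
  us-injective _ _ = enumerate-injective (p ─ q)

  vs-injective : ∀ i j → vs i ≡ vs j → i ≡ j
  vs-injective i j eq = begin
    i                                        ≡⟨ cast-involutive (sym ℓ≡∣q─p∣) ℓ≡∣q─p∣ i ⟨
    cast (sym ℓ≡∣q─p∣) (cast ℓ≡∣q─p∣ i)      ≡⟨ cong (cast (sym ℓ≡∣q─p∣)) (enumerate-injective (q ─ p) eq) ⟩
    cast (sym ℓ≡∣q─p∣) (cast ℓ≡∣q─p∣ j)      ≡⟨ cast-involutive (sym ℓ≡∣q─p∣) ℓ≡∣q─p∣ j ⟩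
    j                                        ∎
    where open ≡-Reasoning

  us-onto : ∀ x → x ∈ p × x ∉ q → ∃ λ i → us i ≡ x
  us-onto x (x∈p , x∉q) = enumerate-surjective (p ─ q) (x∈p∧x∉q⇒x∈p─q x∈p x∉q)

  vs-onto : ∀ x → x ∈ q × x ∉ p → ∃ λ i → vs i ≡ x
  vs-onto x (x∈q , x∉p) =
    let j , eq = enumerate-surjective (q ─ p) (x∈p∧x∉q⇒x∈p─q x∈q x∉p)
    in cast (sym ℓ≡∣q─p∣) j , trans (cong (enumerate (q ─ p)) (cast-involutive ℓ≡∣q─p∣ (sym ℓ≡∣q─p∣) j)) eq

  us-∈ : ∀ i → us i ∈ p × us i ∉ q
  us-∈ i = p─q⊆p p q (enumerate-∈ (p ─ q) i) , x∈p─q⇒x∉q p q (enumerate-∈ (p ─ q) i)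

  vs-∈ : ∀ i → vs i ∈ q × vs i ∉ p
  vs-∈ i = p─q⊆p q p (enumerate-∈ (q ─ p) _) , x∈p─q⇒x∉q q p (enumerate-∈ (q ─ p) _)

  us≢vs : ∀ i → us i ≢ vs i
  us≢vs i eq = proj₂ (us-∈ i) (subst (_∈ q) (sym eq) (proj₁ (vs-∈ i)))

  ℓ≤∣p∣ : ℓ ≤ ∣ p ∣
  ℓ≤∣p∣ = ∣p─q∣≤∣p∣ p q

  p≢q⇒1≤ℓ : p ≢ q → 1 ≤ ℓ
  p≢q⇒1≤ℓ p≢q = n≢0⇒n>0 λ ℓ≡0 → p≢q (∣p─q∣≡0⇒∣q─p∣≡0⇒p≡q p q ℓ≡0 (trans (sym ℓ≡∣q─p∣) ℓ≡0))

avoids : ∀ {n} → List (Fin n) → Subset n → Bool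
avoids ws S = all (λ w → not (w ∈ᵇ S)) ws

avoids-++⁻ˡ : ∀ {n} xs {ys} {S : Subset n} → T (avoids (xs ++ ys) S) → T (avoids xs S)
avoids-++⁻ˡ xs {ys} {S} = all-anti-mono (λ w → not (w ∈ᵇ S)) (∈-++⁺ˡ {xs = xs} {ys = ys})

avoids-++⁻ʳ : ∀ {n} xs {ys} {S : Subset n} → T (avoids (xs ++ ys) S) → T (avoids ys S)
avoids-++⁻ʳ xs {ys} {S} = all-anti-mono (λ w → not (w ∈ᵇ S)) (∈-++⁺ʳ xs {ys = ys})

avoids⇒∉ : ∀ {n} {ws : List (Fin n)} {S x} → T (avoids ws S) → x ∈ₗ ws → x ∉ S
avoids⇒∉ {ws = ws} {S} {x} h x∈ws = not-does⇒ (x ∈? S) (All.lookup (all⁺ _ ws h) x∈ws)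

avoids-members⇒Empty : ∀ {n} {R S : Subset n} → T (avoids (members R) S) → Empty (R ∩ S)
avoids-members⇒Empty {R = R} {S} h (x , x∈R∩S) =
  let x∈R , x∈S = x∈p∩q⁻ R S x∈R∩S in avoids⇒∉ h (∈-members x∈R) x∈S

avoids-members-++⇒Empty : ∀ {n} {p q S : Subset n} → T (avoids (members p ++ members q) S) → Empty (S ∩ (p ∪ q))
avoids-members-++⇒Empty {p = p} {q} {S} h (x , x∈S∩p∪q) with x∈p∩q⁻ S (p ∪ q) x∈S∩p∪q
... | x∈S , x∈p∪q with x∈p∪q⁻ p q x∈p∪q
...   | inj₁ x∈p = avoids⇒∉ h (∈-++⁺ˡ (∈-members x∈p)) x∈S
...   | inj₂ x∈q = avoids⇒∉ h (∈-++⁺ʳ (members p) (∈-members x∈q)) x∈S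

-- Links and common links in a uniform hypergraph

inNᵇ-sound : ∀ {n k} (H : KGraph n k) {u S} → T (inNᵇ H u S) → InN H u S
inNᵇ-sound {k = k} H {u} {S} h =
  let u∉S , rest = T-∧⁻ h
      size , edge = T-∧⁻ rest
  in not-does⇒ (u ∈? S) u∉S , does⇒ (∣ S ∣ ℕ.≟ k ∸ 1) size , Equivalence.to T-≡ edge

deg≤count-inN : ∀ {n k} (H : KGraph n k) x → deg H x ≤ count (inNᵇ H x) (allSubsets n)
deg≤count-inN {suc n} {k} H x = begin
  deg H x                                   ≡⟨ count-allSubsets-insertAt x _ ⟩
  #edges[ inside ] + #edges[ outside ]      ≡⟨ cong (#edges[ inside ] +_) (count-none x∉ (allSubsets n)) ⟩
  #edges[ inside ] + 0                      ≡⟨ +-identityʳ _ ⟩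
  #edges[ inside ]                          ≤⟨ count-mono link (allSubsets n) ⟩
  #links[ outside ]                         ≤⟨ m≤n+m _ #links[ inside ] ⟩
  #links[ inside ] + #links[ outside ]      ≡⟨ count-allSubsets-insertAt x (inNᵇ H x) ⟨
  count (inNᵇ H x) (allSubsets (suc n))     ∎
  where
  open ≤-Reasoning
  #edges[_] #links[_] : Bool → ℕ
  #edges[ b ] = count (λ S → E H (insertAt S x b) ∧ (x ∈ᵇ insertAt S x b)) (allSubsets n)
  #links[ b ] = count (λ S → inNᵇ H x (insertAt S x b)) (allSubsets n)
  x∉ : ∀ S → ¬ T (E H (insertAt S x outside) ∧ (x ∈ᵇ insertAt S x outside))
  x∉ S rewrite ∈ᵇ-insertAt S x outside = subst T (∧-zeroʳ _)
  link : ∀ S → T (E H (insertAt S x inside) ∧ (x ∈ᵇ insertAt S x inside))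
             → T (inNᵇ H x (insertAt S x outside))
  link S h rewrite ∈ᵇ-insertAt S x outside | ∣insertAt-outside∣ S x | insertAt-outside∪⁅x⁆ S x =
    T-∧⁺ (⇒does (∣ S ∣ ℕ.≟ k ∸ 1) (cong pred ∣x∪S∣≡k)) edge
    where
    edge = proj₁ (T-∧⁻ h)
    ∣x∪S∣≡k : suc ∣ S ∣ ≡ k
    ∣x∪S∣≡k = trans (sym (∣insertAt-inside∣ S x)) (uniform H _ (Equivalence.to T-≡ edge))

-- The uniformity is written 2 + k, so D and B are the paper's C(n-1,k-1) and C(n-2,k-2), and every
-- link set has 1 + k elements.
module CommonNeighbourhood {n k : ℕ} (H : KGraph n (2 + k)) where

  D B : ℕ
  D = (n ∸ 1) C (1 + k)
  B = (n ∸ 2) C k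

  common : Fin n → Fin n → Subset n → Bool
  common u v S = inNᵇ H u S ∧ inNᵇ H v S

  -- u and v lie in no common link set, so only the other vertices of a forbidden list cost B each.
  #others : Fin n → Fin n → List (Fin n) → ℕ
  #others u v = count (λ w → not (w =ᶠ u) ∧ not (w =ᶠ v))

  𝒫 : List (Subset n)
  𝒫 = allSubsets n

  -- A member of N(u) ∪ N(v) containing u must lie in N(v): it is a (1 + k)-set avoiding v and containing u.
  count-inN∪inN≤D+B : ∀ {u v} → u ≢ v → count (λ S → inNᵇ H u S ∨ inNᵇ H v S) 𝒫 ≤ D + B
  count-inN∪inN≤D+B {u} {v} u≢v = begin
    count either 𝒫
      ≡⟨ count-split (u ∈ᵇ_) either 𝒫 ⟩
    count (λ S → (u ∈ᵇ S) ∧ either S) 𝒫 + count (λ S → not (u ∈ᵇ S) ∧ either S) 𝒫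
      ≤⟨ +-mono-≤ (count-mono through-u 𝒫) (count-mono avoiding-u 𝒫) ⟩
    count (λ S → size S ∧ not (v ∈ᵇ S) ∧ (u ∈ᵇ S)) 𝒫 + count (λ S → size S ∧ not (u ∈ᵇ S)) 𝒫
      ≡⟨ cong₂ _+_ (count-size∧∉∧∈≡C (u≢v ∘ sym) k) (count-size∧∉≡C u (suc k)) ⟩
    B + D
      ≡⟨ +-comm B D ⟩
    D + B ∎
    where
    open ≤-Reasoning
    either size : Subset n → Bool
    either S = inNᵇ H u S ∨ inNᵇ H v S
    size S = ∣ S ∣ =ᴺ suc k
    through-u : ∀ S → T ((u ∈ᵇ S) ∧ either S) → T (size S ∧ not (v ∈ᵇ S) ∧ (u ∈ᵇ S))
    through-u S = tautology (u ∈ᵇ S) (v ∈ᵇ S) (size S) (E H (S ∪ ⁅ u ⁆)) (E H (S ∪ ⁅ v ⁆))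
      where
      tautology : ∀ a b s x y → T (a ∧ ((not a ∧ s ∧ x) ∨ (not b ∧ s ∧ y))) → T (s ∧ not b ∧ a)
      tautology true  false true  _ _ _ = _
      tautology false _     _     _ _ ()
      tautology true  true  _     _ _ ()
      tautology true  false false _ _ ()
    avoiding-u : ∀ S → T (not (u ∈ᵇ S) ∧ either S) → T (size S ∧ not (u ∈ᵇ S))
    avoiding-u S = tautology (u ∈ᵇ S) (v ∈ᵇ S) (size S) (E H (S ∪ ⁅ u ⁆)) (E H (S ∪ ⁅ v ⁆))
      where
      tautology : ∀ a b s x y → T (not a ∧ ((not a ∧ s ∧ x) ∨ (not b ∧ s ∧ y))) → T (s ∧ not a)
      tautology false _     true  _ _ _ = _
      tautology true  _     _     _ _ ()
      tautology false true  false _ _ ()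
      tautology false false false _ _ ()

  deg+deg≤count-common : ∀ {u v} → u ≢ v → deg H u + deg H v ≤ count (common u v) 𝒫 + (D + B)
  deg+deg≤count-common {u} {v} u≢v = begin
    deg H u + deg H v                                        ≤⟨ +-mono-≤ (deg≤count-inN H u) (deg≤count-inN H v) ⟩
    count (inNᵇ H u) 𝒫 + count (inNᵇ H v) 𝒫                  ≡⟨ count-∧+count-∨ (inNᵇ H u) (inNᵇ H v) 𝒫 ⟩
    count (common u v) 𝒫 + count (λ S → inNᵇ H u S ∨ inNᵇ H v S) 𝒫
                                                             ≤⟨ +-monoʳ-≤ _ (count-inN∪inN≤D+B u≢v) ⟩
    count (common u v) 𝒫 + (D + B)                           ∎
    where open ≤-Reasoning

  common⇒inNˡ : ∀ {u v S} → T (common u v S) → InN H u S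
  common⇒inNˡ {u} {v} {S} h = inNᵇ-sound H {u} {S} (proj₁ (T-∧⁻ {inNᵇ H u S} h))

  common⇒inNʳ : ∀ {u v S} → T (common u v S) → InN H v S
  common⇒inNʳ {u} {v} {S} h = inNᵇ-sound H {v} {S} (proj₂ (T-∧⁻ {inNᵇ H u S} h))

  count-common∧∈≤B : ∀ u v {w} → w ≢ u → count (λ S → common u v S ∧ (w ∈ᵇ S)) 𝒫 ≤ B
  count-common∧∈≤B u v {w} w≢u =
    ≤-trans (count-mono meets 𝒫) (≤-reflexive (count-size∧∉∧∈≡C (w≢u ∘ sym) k))
    where
    meets : ∀ S → T (common u v S ∧ (w ∈ᵇ S)) → T ((∣ S ∣ =ᴺ suc k) ∧ not (u ∈ᵇ S) ∧ (w ∈ᵇ S))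
    meets S h =
      let uv , w∈S = T-∧⁻ {common u v S} h
          u∉S , size∧edge = T-∧⁻ {not (u ∈ᵇ S)} (proj₁ (T-∧⁻ {inNᵇ H u S} uv))
      in T-∧⁺ (proj₁ (T-∧⁻ {∣ S ∣ =ᴺ suc k} size∧edge)) (T-∧⁺ u∉S w∈S)

  count-common∧∈endpoint≡0 : ∀ u v {w} → w ≡ u ⊎ w ≡ v → count (λ S → common u v S ∧ (w ∈ᵇ S)) 𝒫 ≡ 0
  count-common∧∈endpoint≡0 u v {w} endpoint = count-none (λ S h →
    let uv , w∈S = T-∧⁻ {common u v S} h
    in endpoint∉ endpoint uv (does⇒ (w ∈? S) w∈S)) 𝒫
    where
    endpoint∉ : ∀ {S} → w ≡ u ⊎ w ≡ v → T (common u v S) → w ∉ S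
    endpoint∉ {S} (inj₁ refl) uv = proj₁ (common⇒inNˡ {u} {v} {S} uv)
    endpoint∉ {S} (inj₂ refl) uv = proj₁ (common⇒inNʳ {u} {v} {S} uv)

  count-common∧∈+#others≤ : ∀ u v w ws →
    count (λ S → common u v S ∧ (w ∈ᵇ S)) 𝒫 + #others u v ws * B ≤ #others u v (w ∷ ws) * B
  count-common∧∈+#others≤ u v w ws with w ≟ u | w ≟ v
  ... | yes refl | _        = ≤-reflexive (cong (_+ #others u v ws * B) (count-common∧∈endpoint≡0 u v (inj₁ refl)))
  ... | no _     | yes refl = ≤-reflexive (cong (_+ #others u v ws * B) (count-common∧∈endpoint≡0 u v (inj₂ refl)))
  ... | no w≢u   | no _     = +-monoˡ-≤ (#others u v ws * B) (count-common∧∈≤B u v w≢u)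

  count-common≤count-avoiding : ∀ u v ws →
    count (common u v) 𝒫 ≤ count (λ S → common u v S ∧ avoids ws S) 𝒫 + #others u v ws * B
  count-common≤count-avoiding u v [] =
    ≤-trans (count-mono (λ S h → T-∧⁺ {common u v S} h _) 𝒫) (m≤m+n _ 0)
  count-common≤count-avoiding u v (w ∷ ws) = begin
    count (common u v) 𝒫
      ≤⟨ count-common≤count-avoiding u v ws ⟩
    count P 𝒫 + #others u v ws * B
      ≡⟨ cong (_+ #others u v ws * B) (count-split (w ∈ᵇ_) P 𝒫) ⟩
    count (λ S → (w ∈ᵇ S) ∧ P S) 𝒫 + count (λ S → not (w ∈ᵇ S) ∧ P S) 𝒫 + #others u v ws * B
      ≤⟨ +-monoˡ-≤ (#others u v ws * B) (+-mono-≤ (count-mono meets-w 𝒫) (count-mono avoids-w 𝒫)) ⟩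
    #meeting + #avoiding + #others u v ws * B
      ≡⟨ cong (_+ #others u v ws * B) (+-comm #meeting #avoiding) ⟩
    #avoiding + #meeting + #others u v ws * B
      ≡⟨ +-assoc #avoiding #meeting _ ⟩
    #avoiding + (#meeting + #others u v ws * B)
      ≤⟨ +-monoʳ-≤ #avoiding (count-common∧∈+#others≤ u v w ws) ⟩
    #avoiding + #others u v (w ∷ ws) * B ∎
    where
    open ≤-Reasoning
    P : Subset n → Bool
    P S = common u v S ∧ avoids ws S
    #meeting #avoiding : ℕ
    #meeting = count (λ S → common u v S ∧ (w ∈ᵇ S)) 𝒫
    #avoiding = count (λ S → common u v S ∧ avoids (w ∷ ws) S) 𝒫
    meets-w : ∀ S → T ((w ∈ᵇ S) ∧ P S) → T (common u v S ∧ (w ∈ᵇ S))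
    meets-w S h = let w∈S , uv∧ws = T-∧⁻ {w ∈ᵇ S} h in T-∧⁺ (proj₁ (T-∧⁻ {common u v S} uv∧ws)) w∈S
    avoids-w : ∀ S → T (not (w ∈ᵇ S) ∧ P S) → T (common u v S ∧ avoids (w ∷ ws) S)
    avoids-w S h =
      let w∉S , uv∧ws = T-∧⁻ {not (w ∈ᵇ S)} h
          uv , ws∉S = T-∧⁻ {common u v S} uv∧ws
      in T-∧⁺ uv (T-∧⁺ w∉S ws∉S)

  #others-++≤ : ∀ {u v} S ws → #others u v (members S ++ ws) ≤ ∣ S ∣ + #others u v ws
  #others-++≤ {u} {v} S ws = begin
    #others u v (members S ++ ws)                 ≡⟨ count-++ _ (members S) ws ⟩
    #others u v (members S) + #others u v ws      ≤⟨ +-monoˡ-≤ _ (count≤length _ (members S)) ⟩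
    length (members S) + #others u v ws           ≡⟨ cong (_+ #others u v ws) (length-members S) ⟩
    ∣ S ∣ + #others u v ws                        ∎
    where open ≤-Reasoning

  #others-members< : ∀ {u v} R → u ∈ R ⊎ v ∈ R → #others u v (members R) < ∣ R ∣
  #others-members< {u} {v} R (inj₁ u∈R) =
    subst (#others u v (members R) <_) (length-members R)
      (count<length _ (members R) (∈-members u∈R) (λ h → not-does⇒ (u ≟ u) (proj₁ (T-∧⁻ {not (u =ᶠ u)} h)) refl))
  #others-members< {u} {v} R (inj₂ v∈R) =
    subst (#others u v (members R) <_) (length-members R)
      (count<length _ (members R) (∈-members v∈R) (λ h → not-does⇒ (v ≟ v) (proj₂ (T-∧⁻ {not (v =ᶠ u)} h)) refl))

  #others-edges+reserve≤ : ∀ {u v e f ℓ} → ∣ e ∣ ≡ 2 + k → ∣ f ∣ ≡ 2 + k → u ∈ e → v ∈ f → ℓ ≤ 2 + k →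
    #others u v (members e ++ members f) + (1 + k) * ℓ ≤ (1 + k) + (2 + k) * (2 + k)
  #others-edges+reserve≤ {u} {v} {e} {f} {ℓ} ∣e∣ ∣f∣ u∈e v∈f ℓ≤k = begin
    #others u v (members e ++ members f) + (1 + k) * ℓ
      ≡⟨ cong (_+ (1 + k) * ℓ) (count-++ _ (members e) (members f)) ⟩
    #others u v (members e) + #others u v (members f) + (1 + k) * ℓ
      ≤⟨ +-mono-≤ (+-mono-≤ (few e ∣e∣ (inj₁ u∈e)) (few f ∣f∣ (inj₂ v∈f))) (*-monoʳ-≤ (1 + k) ℓ≤k) ⟩
    (1 + k) + (1 + k) + (1 + k) * (2 + k)
      ≡⟨ +-assoc (1 + k) (1 + k) _ ⟩
    (1 + k) + ((1 + k) + (1 + k) * (2 + k))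
      ≤⟨ +-monoʳ-≤ (1 + k) (n≤1+n _) ⟩
    (1 + k) + suc ((1 + k) + (1 + k) * (2 + k))
      ≡⟨ cong ((1 + k) +_) (square k) ⟩
    (1 + k) + (2 + k) * (2 + k) ∎
    where
    open ≤-Reasoning
    few : ∀ R → ∣ R ∣ ≡ 2 + k → u ∈ R ⊎ v ∈ R → #others u v (members R) ≤ 1 + k
    few R ∣R∣ endpoint∈R = ≤-pred (subst (#others u v (members R) <_) ∣R∣ (#others-members< R endpoint∈R))
    square : ∀ k → suc ((1 + k) + (1 + k) * (2 + k)) ≡ (2 + k) * (2 + k)
    square = solve-∀

  module _ (min-degree : ∀ x → D + ((2 + k) * (2 + k) + 1) * B < 2 * deg H x) where

    k²B<count-common : ∀ {u v} → u ≢ v → (2 + k) * (2 + k) * B < count (common u v) 𝒫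
    k²B<count-common {u} {v} u≢v = +-cancelˡ-≤ (D + B) _ _ (*-cancelˡ-≤ 2 (begin
      2 * (D + B + suc (K² * B))                                  ≡⟨ double D B K² ⟩
      suc (D + (K² + 1) * B) + suc (D + (K² + 1) * B)             ≤⟨ +-mono-≤ (min-degree u) (min-degree v) ⟩
      2 * deg H u + 2 * deg H v                                   ≡⟨ *-distribˡ-+ 2 (deg H u) (deg H v) ⟨
      2 * (deg H u + deg H v)                                     ≤⟨ *-monoʳ-≤ 2 (deg+deg≤count-common u≢v) ⟩
      2 * (count (common u v) 𝒫 + (D + B))                        ≡⟨ cong (2 *_) (+-comm (count (common u v) 𝒫) (D + B)) ⟩
      2 * (D + B + count (common u v) 𝒫)                          ∎))
      where
      open ≤-Reasoning
      K² = (2 + k) * (2 + k)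
      double : ∀ d b q → 2 * (d + b + suc (q * b)) ≡ suc (d + (q + 1) * b) + suc (d + (q + 1) * b)
      double = solve-∀

    common-neighbour-avoiding : ∀ {u v} ws → u ≢ v → #others u v ws ≤ (2 + k) * (2 + k) →
      ∃ λ S → T (common u v S) × T (avoids ws S)
    common-neighbour-avoiding {u} {v} ws u≢v few =
      let S , h = count-witness _ 𝒫 0<#avoiding in S , T-∧⁻ {common u v S} h
      where
      #avoiding = count (λ S → common u v S ∧ avoids ws S) 𝒫
      0<#avoiding : 0 < #avoiding
      0<#avoiding = +-cancelʳ-< ((2 + k) * (2 + k) * B) 0 #avoiding (begin-strict
        (2 + k) * (2 + k) * B             <⟨ k²B<count-common u≢v ⟩
        count (common u v) 𝒫              ≤⟨ count-common≤count-avoiding u v ws ⟩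
        #avoiding + #others u v ws * B    ≤⟨ +-monoʳ-≤ #avoiding (*-monoˡ-≤ B few) ⟩
        #avoiding + (2 + k) * (2 + k) * B ∎)
        where open ≤-Reasoning

    -- The term (1 + k) * ℓ reserves room in the budget for the members of the link sets still to be chosen.
    disjoint-common-neighbours : ∀ ℓ (us vs : Fin ℓ → Fin n) ws →
      (∀ i → us i ≢ vs i) →
      (∀ i → #others (us i) (vs i) ws + (1 + k) * ℓ ≤ (1 + k) + (2 + k) * (2 + k)) →
      Σ (Fin ℓ → Subset n) λ Ts →
        (∀ i → T (common (us i) (vs i) (Ts i))) ×
        (∀ i j → i ≢ j → Empty (Ts i ∩ Ts j)) ×
        (∀ i → T (avoids ws (Ts i)))
    disjoint-common-neighbours zero    us vs ws _     _      = (λ ()) , (λ ()) , (λ ()) , (λ ())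
    disjoint-common-neighbours (suc ℓ) us vs ws us≢vs budget = Ts , common-Ts , disjoint-Ts , avoids-Ts
      where
      shift : ∀ a o m → a + o + a * m ≡ o + a * suc m
      shift = solve-∀
      first : ∃ λ S → T (common (us zero) (vs zero) S) × T (avoids ws S)
      first = common-neighbour-avoiding ws (us≢vs zero) (+-cancelˡ-≤ (1 + k) _ _
        (≤-trans (m≤m+n _ ((1 + k) * ℓ)) (≤-trans (≤-reflexive (shift (1 + k) _ ℓ)) (budget zero))))
      S₀ = proj₁ first
      ∣S₀∣ : ∣ S₀ ∣ ≡ 1 + k
      ∣S₀∣ = proj₁ (proj₂ (common⇒inNˡ {us zero} {vs zero} {S₀} (proj₁ (proj₂ first))))
      rest = disjoint-common-neighbours ℓ (us ∘ suc) (vs ∘ suc) (members S₀ ++ ws) (us≢vs ∘ suc) λ i →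
        ≤-trans (+-monoˡ-≤ ((1 + k) * ℓ) (≤-trans (#others-++≤ {us (suc i)} {vs (suc i)} S₀ ws)
                                                   (+-monoˡ-≤ _ (≤-reflexive ∣S₀∣))))
                (≤-trans (≤-reflexive (shift (1 + k) _ ℓ)) (budget (suc i)))
      Ts : Fin (suc ℓ) → Subset n
      Ts zero    = S₀
      Ts (suc i) = proj₁ rest i
      common-Ts : ∀ i → T (common (us i) (vs i) (Ts i))
      common-Ts zero    = proj₁ (proj₂ first)
      common-Ts (suc i) = proj₁ (proj₂ rest) i
      avoids-rest : ∀ i → T (avoids (members S₀ ++ ws) (Ts (suc i)))
      avoids-rest = proj₂ (proj₂ (proj₂ rest))
      avoids-Ts : ∀ i → T (avoids ws (Ts i))
      avoids-Ts zero    = proj₂ (proj₂ first)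
      avoids-Ts (suc i) = avoids-++⁻ʳ (members S₀) (avoids-rest i)
      disjoint-Ts : ∀ i j → i ≢ j → Empty (Ts i ∩ Ts j)
      disjoint-Ts zero    zero    0≢0 = ⊥-elim (0≢0 refl)
      disjoint-Ts zero    (suc j) _   = avoids-members⇒Empty (avoids-++⁻ˡ (members S₀) (avoids-rest j))
      disjoint-Ts (suc i) zero    _   =
        subst Empty (∩-comm S₀ (Ts (suc i))) (avoids-members⇒Empty (avoids-++⁻ˡ (members S₀) (avoids-rest i)))
      disjoint-Ts (suc i) (suc j) i≢j = proj₁ (proj₂ (proj₂ rest)) i j (i≢j ∘ cong suc)

-- Colour types of pairs of vertices

module Colouring {n k r : ℕ} (H : KGraph n (2 + k)) (c : Subset n → Fin r) where

  open CommonNeighbourhood H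

  colour : Fin n → Subset n → Fin r
  colour u S = c (_·_ H u S)

  profile-++-differs : ∀ {A : Set} (g h : A → Subset n) xs {e f} → (∀ x → c (g x) ≡ c (h x)) → c e ≢ c f →
    DiffProfile H c (map g xs ++ (f ∷ [])) (map h xs ++ (e ∷ []))
  profile-++-differs g h xs {e} {f} c∘g≗c∘h ce≢cf = c e , λ eq → 0≢1+n (+-cancelˡ-≡ #g 0 1 (begin
    #g + 0                                             ≡⟨ cong (#g +_) (count-∷-false {p = coloured-ce} [] cf≢ce) ⟨
    #g + count coloured-ce (f ∷ [])                    ≡⟨ count-++ coloured-ce (map g xs) (f ∷ []) ⟨
    profile H c (map g xs ++ (f ∷ [])) (c e)           ≡⟨ eq ⟩
    profile H c (map h xs ++ (e ∷ [])) (c e)           ≡⟨ count-++ coloured-ce (map h xs) (e ∷ []) ⟩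
    count coloured-ce (map h xs) + count coloured-ce (e ∷ [])
      ≡⟨ cong₂ _+_ (count-map-cong coloured-ce (λ x → cong (_=ᶠ c e) (sym (c∘g≗c∘h x))) xs)
                   (count-∷-true {p = coloured-ce} [] (⇒does (c e ≟ c e) refl)) ⟩
    #g + 1                                             ∎))
    where
    open ≡-Reasoning
    coloured-ce : Subset n → Bool
    coloured-ce x = c x =ᶠ c e
    #g = count coloured-ce (map g xs)
    cf≢ce : ¬ T (coloured-ce f)
    cf≢ce = ce≢cf ∘ sym ∘ does⇒ (c f ≟ c e)

  module _ (min-degree : ∀ x → D + ((2 + k) * (2 + k) + 1) * B < 2 * deg H x) where

    gadget₃-of-unsplit : (∀ {u v S} → u ≢ v → T (common u v S) → colour u S ≡ colour v S) →
      ∀ {e f} → IsEdge H e → IsEdge H f → c e ≢ c f → GoodGadget3 H c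
    gadget₃-of-unsplit unsplit {e} {f} edge-e edge-f ce≢cf =
      e , f , ℓ , us , vs , Ts , edge-e , edge-f , p≢q⇒1≤ℓ (ce≢cf ∘ cong c) , ℓ≤2+k ,
      us-injective , us-onto , us-∈ , vs-injective , vs-onto , vs-∈ ,
      proj₁ (proj₂ (proj₂ greedy)) ,
      (λ i → common⇒inNˡ {us i} {vs i} {Ts i} (common-Ts i) , common⇒inNʳ {us i} {vs i} {Ts i} (common-Ts i)) ,
      (λ i → avoids-members-++⇒Empty (proj₂ (proj₂ (proj₂ greedy)) i)) ,
      profile-++-differs (λ i → _·_ H (us i) (Ts i)) (λ i → _·_ H (vs i) (Ts i)) (allFin ℓ)
                         (λ i → unsplit (us≢vs i) (common-Ts i)) ce≢cf
      where
      ∣e∣ : ∣ e ∣ ≡ 2 + k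
      ∣e∣ = uniform H e edge-e
      ∣f∣ : ∣ f ∣ ≡ 2 + k
      ∣f∣ = uniform H f edge-f
      open DifferencePairing e f (trans ∣e∣ (sym ∣f∣))
      ℓ≤2+k : ℓ ≤ 2 + k
      ℓ≤2+k = subst (ℓ ≤_) ∣e∣ ℓ≤∣p∣
      greedy = disjoint-common-neighbours min-degree ℓ us vs (members e ++ members f) us≢vs λ i →
        #others-edges+reserve≤ ∣e∣ ∣f∣ (proj₁ (us-∈ i)) (proj₁ (vs-∈ i)) ℓ≤2+k
      Ts : Fin ℓ → Subset n
      Ts = proj₁ greedy
      common-Ts : ∀ i → T (common (us i) (vs i) (Ts i))
      common-Ts = proj₁ (proj₂ greedy)

  module _ (no-gadget₁ : ¬ GoodGadget1 H c) where

    -- If c(uS₂) ≠ c(uS₁), the colour c(uS₁) occurs in {uS₁, vS₂} but not in {vS₁, uS₂};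
    -- if c(vS₂) ≠ c(vS₁), the colour c(vS₁) occurs in {vS₁, uS₂} but not in {uS₁, vS₂}.
    colours-agree-on-disjoint : ∀ {u v S₁ S₂} → u ≢ v →
      T (common u v S₁) → T (common u v S₂) → Empty (S₁ ∩ S₂) → colour u S₁ ≢ colour v S₁ →
      colour u S₂ ≡ colour u S₁ × colour v S₂ ≡ colour v S₁
    colours-agree-on-disjoint {u} {v} {S₁} {S₂} u≢v uv₁ uv₂ S₁∩S₂=∅ split₁ =
      decide (colour u S₂ ≟ colour u S₁) (colour v S₂ ≟ colour v S₁)
      where
      gadget : DiffProfile H c (_·_ H u S₁ ∷ _·_ H v S₂ ∷ []) (_·_ H v S₁ ∷ _·_ H u S₂ ∷ []) → GoodGadget1 H c
      gadget diff = u , v , S₁ , S₂ , u≢v , S₁∩S₂=∅ ,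
        common⇒inNˡ {u} {v} {S₁} uv₁ , common⇒inNʳ {u} {v} {S₁} uv₁ ,
        common⇒inNˡ {u} {v} {S₂} uv₂ , common⇒inNʳ {u} {v} {S₂} uv₂ , diff
      coloured : ∀ {e i} → c e ≡ i → T (c e =ᶠ i)
      coloured {e} {i} = ⇒does (c e ≟ i)
      uncoloured : ∀ {e i} → c e ≢ i → ¬ T (c e =ᶠ i)
      uncoloured {e} {i} ≢i = ≢i ∘ does⇒ (c e ≟ i)
      decide : Dec (colour u S₂ ≡ colour u S₁) → Dec (colour v S₂ ≡ colour v S₁) →
        colour u S₂ ≡ colour u S₁ × colour v S₂ ≡ colour v S₁
      decide (yes eq₁) (yes eq₂) = eq₁ , eq₂
      decide (no neq₁) _ = ⊥-elim (no-gadget₁ (gadget (colour u S₁ ,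
        count-∷∷-≢ (λ e → c e =ᶠ colour u S₁) (coloured refl) (uncoloured (split₁ ∘ sym)) (uncoloured neq₁))))
      decide (yes _) (no neq₂) = ⊥-elim (no-gadget₁ (gadget (colour v S₁ ,
        ≢-sym (count-∷∷-≢ (λ e → c e =ᶠ colour v S₁) (coloured refl) (uncoloured split₁) (uncoloured neq₂)))))

    module _ (min-degree : ∀ x → D + ((2 + k) * (2 + k) + 1) * B < 2 * deg H x) (0<B : 0 < B) where

      -- S₀ and S are both compared with a common link set S′ disjoint from both.
      colours-constant : ∀ {u v S₀ S} → u ≢ v → T (common u v S₀) → colour u S₀ ≢ colour v S₀ →
        T (common u v S) → colour u S ≡ colour u S₀ × colour v S ≡ colour v S₀
      colours-constant {u} {v} {S₀} {S} u≢v uv₀ split₀ uv =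
        let S′ , uv′ , avoid = common-neighbour-avoiding min-degree ws u≢v few
            eq₁ , eq₂ = colours-agree-on-disjoint u≢v uv₀ uv′
                          (avoids-members⇒Empty (avoids-++⁻ˡ (members S₀) avoid)) split₀
            split′ = λ eq → split₀ (trans (sym eq₁) (trans eq eq₂))
            eq₃ , eq₄ = colours-agree-on-disjoint u≢v uv′ uv
                          (subst Empty (∩-comm S S′) (avoids-members⇒Empty (avoids-++⁻ʳ (members S₀) avoid))) split′
        in trans eq₃ eq₁ , trans eq₄ eq₂
        where
        ws = members S₀ ++ members S
        size : ∀ {S} → T (common u v S) → length (members S) ≡ 1 + k
        size {S} uv = trans (length-members S) (proj₁ (proj₂ (common⇒inNˡ {u} {v} {S} uv)))
        few : #others u v ws ≤ (2 + k) * (2 + k)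
        few = begin
          #others u v ws                          ≤⟨ count≤length _ ws ⟩
          length ws                               ≡⟨ length-++ (members S₀) ⟩
          length (members S₀) + length (members S) ≡⟨ cong₂ _+_ (size uv₀) (size uv) ⟩
          (1 + k) + (1 + k)                       ≤⟨ m≤m+n _ _ ⟩
          (1 + k) + (1 + k) + (2 + k * (2 + k))   ≡⟨ square k ⟩
          (2 + k) * (2 + k)                       ∎
          where
          open ≤-Reasoning
          square : ∀ k → (1 + k) + (1 + k) + (2 + k * (2 + k)) ≡ (2 + k) * (2 + k)
          square = solve-∀

      S-sound : ∀ {u v S} → T (inNᵇ H u S ∧ inNᵇ H v S ∧ (colour u S =ᶠ colour v S)) →
        T (common u v S) × colour u S ≡ colour v S
      S-sound {u} {v} {S} h =
        let Nu , Nv∧eq = T-∧⁻ {inNᵇ H u S} h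
            Nv , eq = T-∧⁻ {inNᵇ H v S} Nv∧eq
        in T-∧⁺ Nu Nv , does⇒ (colour u S ≟ colour v S) eq

      S-complete : ∀ {u v S} → T (common u v S) → colour u S ≡ colour v S →
        T (inNᵇ H u S ∧ inNᵇ H v S ∧ (colour u S =ᶠ colour v S))
      S-complete {u} {v} {S} uv eq =
        let Nu , Nv = T-∧⁻ {inNᵇ H u S} uv
        in T-∧⁺ Nu (T-∧⁺ Nv (⇒does (colour u S ≟ colour v S) eq))

      CC-sound : ∀ {u v S i j} → T (inNᵇ H u S ∧ inNᵇ H v S ∧ (colour u S =ᶠ i) ∧ (colour v S =ᶠ j)) →
        T (common u v S) × colour u S ≡ i × colour v S ≡ j
      CC-sound {u} {v} {S} {i} {j} h =
        let Nu , rest = T-∧⁻ {inNᵇ H u S} h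
            Nv , ci∧cj = T-∧⁻ {inNᵇ H v S} rest
            ci , cj = T-∧⁻ {colour u S =ᶠ i} ci∧cj
        in T-∧⁺ Nu Nv , does⇒ (colour u S ≟ i) ci , does⇒ (colour v S ≟ j) cj

      CC-complete : ∀ {u v S i j} → T (common u v S) → colour u S ≡ i → colour v S ≡ j →
        T (inNᵇ H u S ∧ inNᵇ H v S ∧ (colour u S =ᶠ i) ∧ (colour v S =ᶠ j))
      CC-complete {u} {v} {S} {i} {j} uv ci cj =
        let Nu , Nv = T-∧⁻ {inNᵇ H u S} uv
        in T-∧⁺ Nu (T-∧⁺ Nv (T-∧⁺ (⇒does (colour u S ≟ i) ci) (⇒does (colour v S ≟ j) cj)))

      0<thr : 0 < thr H c
      0<thr = *-mono-≤ {1} {(2 + k) * (2 + k)} (s≤s z≤n) 0<B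

      split : Fin n → Fin n → Subset n → Bool
      split u v S = not (colour u S =ᶠ colour v S) ∧ common u v S

      typeS-of-unsplit : ∀ {u v} → u ≢ v → count (split u v) 𝒫 ≡ 0 →
        TypeS H c u v × (∀ i j → i ≢ j → ¬ TypeCC H c i j u v)
      typeS-of-unsplit {u} {v} u≢v no-split = typeS , ¬typeCC
        where
        agree : Subset n → Bool
        agree S = (colour u S =ᶠ colour v S) ∧ common u v S
        typeS : TypeS H c u v
        typeS = <⇒≤ (begin-strict
          thr H c                                     <⟨ k²B<count-common min-degree u≢v ⟩
          count (common u v) 𝒫                        ≡⟨ count-split (λ S → colour u S =ᶠ colour v S) (common u v) 𝒫 ⟩
          count agree 𝒫 + count (split u v) 𝒫         ≡⟨ cong (count agree 𝒫 +_) no-split ⟩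
          count agree 𝒫 + 0                           ≡⟨ +-identityʳ _ ⟩
          count agree 𝒫                               ≤⟨ count-mono agree⇒S 𝒫 ⟩
          countS H c u v                              ∎)
          where
          open ≤-Reasoning
          agree⇒S : ∀ S → T (agree S) → T (inNᵇ H u S ∧ inNᵇ H v S ∧ (colour u S =ᶠ colour v S))
          agree⇒S S h = let eq , uv = T-∧⁻ {colour u S =ᶠ colour v S} h
                        in S-complete uv (does⇒ (colour u S ≟ colour v S) eq)
        ¬typeCC : ∀ i j → i ≢ j → ¬ TypeCC H c i j u v
        ¬typeCC i j i≢j typeCC =
          <⇒≱ 0<thr (≤-trans typeCC (≤-trans (count-mono CC⇒split 𝒫) (≤-reflexive no-split)))
          where
          CC⇒split : ∀ S → T (inNᵇ H u S ∧ inNᵇ H v S ∧ (colour u S =ᶠ i) ∧ (colour v S =ᶠ j)) → T (split u v S)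
          CC⇒split S h =
            let uv , ci , cj = CC-sound {u} {v} {S} h
            in T-∧⁺ (⇒not-does (colour u S ≟ colour v S) (λ eq → i≢j (trans (sym ci) (trans eq cj)))) uv

      typeCC-of-split : ∀ {u v S₀} → u ≢ v → T (common u v S₀) → colour u S₀ ≢ colour v S₀ →
        TypeCC H c (colour u S₀) (colour v S₀) u v × ¬ TypeS H c u v ×
        (∀ i j → i ≢ j → TypeCC H c i j u v → i ≡ colour u S₀ × j ≡ colour v S₀)
      typeCC-of-split {u} {v} {S₀} u≢v uv₀ split₀ = typeCC , ¬typeS , unique
        where
        constant : ∀ {S} → T (common u v S) → colour u S ≡ colour u S₀ × colour v S ≡ colour v S₀
        constant = colours-constant u≢v uv₀ split₀
        typeCC : TypeCC H c (colour u S₀) (colour v S₀) u v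
        typeCC = <⇒≤ (<-≤-trans (k²B<count-common min-degree u≢v)
                                 (count-mono (λ S uv → let e₁ , e₂ = constant uv in CC-complete uv e₁ e₂) 𝒫))
        ¬typeS : ¬ TypeS H c u v
        ¬typeS typeS = <⇒≱ 0<thr (≤-trans typeS (≤-reflexive (count-none never-S 𝒫)))
          where
          never-S : ∀ S → ¬ T (inNᵇ H u S ∧ inNᵇ H v S ∧ (colour u S =ᶠ colour v S))
          never-S S h = let uv , eq = S-sound {u} {v} {S} h
                            e₁ , e₂ = constant uv
                        in split₀ (trans (sym e₁) (trans eq e₂))
        unique : ∀ i j → i ≢ j → TypeCC H c i j u v → i ≡ colour u S₀ × j ≡ colour v S₀
        unique i j _ typeCC′ =
          let S , h = count-witness _ 𝒫 (<-≤-trans 0<thr typeCC′)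
              uv , ci , cj = CC-sound {u} {v} {S} h
              e₁ , e₂ = constant uv
          in trans (sym ci) e₁ , trans (sym cj) e₂

      unique-type : ∀ u v → u ≢ v →
          (TypeS H c u v × (∀ i j → i ≢ j → ¬ TypeCC H c i j u v))
        ⊎ (Σ (Fin r) λ i → Σ (Fin r) λ j → i ≢ j × TypeCC H c i j u v × ¬ TypeS H c u v ×
             (∀ i′ j′ → i′ ≢ j′ → TypeCC H c i′ j′ u v → i′ ≡ i × j′ ≡ j))
      unique-type u v u≢v with count (split u v) 𝒫 in #split
      ... | zero  = inj₁ (typeS-of-unsplit u≢v #split)
      ... | suc _ =
        let S₀ , h = count-witness (split u v) 𝒫 (subst (0 <_) (sym #split) (s≤s z≤n))
            ≢ᵇ , uv₀ = T-∧⁻ {not (colour u S₀ =ᶠ colour v S₀)} h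
            split₀ = not-does⇒ (colour u S₀ ≟ colour v S₀) ≢ᵇ
        in inj₂ (colour u S₀ , colour v S₀ , split₀ , typeCC-of-split u≢v uv₀ split₀)

      all-typeS⇒unsplit : (∀ u v → u ≢ v → TypeS H c u v) →
        ∀ {u v S} → u ≢ v → T (common u v S) → colour u S ≡ colour v S
      all-typeS⇒unsplit typeS {u} {v} {S} u≢v uv with colour u S ≟ colour v S
      ... | yes eq    = eq
      ... | no split₀ = ⊥-elim (proj₁ (proj₂ (typeCC-of-split u≢v uv split₀)) (typeS u v u≢v))

      some-pair-not-typeS : ¬ GoodGadget3 H c →
        (Σ (Subset n) λ e → Σ (Subset n) λ f → IsEdge H e × IsEdge H f × c e ≢ c f) →
        Σ (Fin n) λ u → Σ (Fin n) λ v → u ≢ v × ¬ TypeS H c u v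
      some-pair-not-typeS no-gadget₃ (e , f , edge-e , edge-f , ce≢cf)
        with any? (λ u → any? (λ v → ¬? (u ≟ v) ×-dec ¬? (thr H c ℕ.≤? countS H c u v)))
      ... | yes (u , v , u≢v , ¬typeS) = u , v , u≢v , ¬typeS
      ... | no ∄ = ⊥-elim (no-gadget₃ (gadget₃-of-unsplit min-degree (all-typeS⇒unsplit all-typeS) edge-e edge-f ce≢cf))
        where
        all-typeS : ∀ u v → u ≢ v → TypeS H c u v
        all-typeS u v u≢v = decidable-stable (thr H c ℕ.≤? countS H c u v) (λ ¬typeS → ∄ (u , v , u≢v , ¬typeS))

lemma3p3 : (n k r : ℕ) → 2 ≤ k → 2 * (k * k) ≤ n → 2 ≤ r →
    (H : KGraph n k) → (c : Subset n → Fin r) →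
    ¬ GoodGadget1 H c → ¬ GoodGadget2 H c → ¬ GoodGadget3 H c →
    -- δ(H) > ½ binom(n-1,k-1) + ((k²+1)/2) binom(n-2,k-2), doubled
    (∀ x → (n ∸ 1) C (k ∸ 1) + (k * k + 1) * ((n ∸ 2) C (k ∸ 2)) < 2 * deg H x) →
    -- (A) every ordered pair of distinct vertices has a unique type
    ((u v : Fin n) → u ≢ v →
        (TypeS H c u v × (∀ i j → i ≢ j → ¬ TypeCC H c i j u v))
      ⊎ (Σ (Fin r) λ i → Σ (Fin r) λ j → i ≢ j × TypeCC H c i j u v ×
           ¬ TypeS H c u v ×
           (∀ i′ j′ → i′ ≢ j′ → TypeCC H c i′ j′ u v → i′ ≡ i × j′ ≡ j)))
    ×
    -- (B) if c is not monochromatic, some pair is not of type S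
    ((Σ (Subset n) λ e → Σ (Subset n) λ f →
        IsEdge H e × IsEdge H f × c e ≢ c f) →
      Σ (Fin n) λ u → Σ (Fin n) λ v → u ≢ v × ¬ TypeS H c u v)
lemma3p3 n (suc (suc k)) r (s≤s (s≤s z≤n)) 2k²≤n _ H c no-gadget₁ _ no-gadget₃ min-degree =
  unique-type no-gadget₁ min-degree 0<B , some-pair-not-typeS no-gadget₁ min-degree 0<B no-gadget₃
  where
  open Colouring H c
  k+2≤n : k + 2 ≤ n
  k+2≤n = ≤-trans (≤-reflexive (+-comm k 2)) (≤-trans (m≤m*n (2 + k) (2 + k)) (≤-trans (m≤m+n _ _) 2k²≤n))
  0<B : 0 < (n ∸ 2) C k
  0<B = 0<C (m+n≤o⇒m≤o∸n k k+2≤n)
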